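{- Let $G$ be a simple cubic graph with a polyhedral embedding $\Pi$ and extended graph $G^e=G^e(\Pi)$. Let $(u\,t_0\,t_1\,v)$ and $(u\,t_2\,t_3\,v)$ be two internally disjoint $3$-paths in $G$ such that $[uv]$ is a scaffold edge of $G^e$ and $(u\,t_0\,t_1\,v)$ is not a $\Pi$-facial subwalk. Then $(u\,t_2\,t_3\,v)$ is a $\Pi$-facial subwalk.
   Context: An embedding of a graph in a surface without boundary is polyhedral if every facial walk is a cycle and any two distinct facial cycles intersect in either the empty set, a single vertex, or a single edge. A $\Pi$-facial subwalk is a walk formed by consecutive vertices of some $\Pi$-facial cycle (in either direction). The extended graph $G^e(\Pi)$ has vertex set $V(G)$ and edge set $E(G)$ together with a multiset $\mathcal S$ of scaffold edges: for distinct vertices $t_0,t_3$, the scaffold edge $[t_0t_3]$ appears with multiplicity equal to the number of paths $(t_0t_1t_2t_3)$ of $G$ that are $\Pi$-facial subwalks; $[uv]$ is a scaffold edge if its multiplicity is at least $1$. -}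

module Defs where

open import Data.Nat using (ℕ; zero; suc; _+_; _≤_; _<_)
open import Data.Fin using (Fin; _≟_)
open import Data.Bool using (Bool; true; false; T; _∧_; _∨_)
open import Data.List using (List; []; _∷_; length; map; upTo; filterᵇ; reverse)
open import Data.Nat.ListAction using (sum)
open import Data.Empty using (⊥)
open import Data.List using () renaming (allFin to allFinL)
open import Data.Product using (Σ; ∃; ∃-syntax; _×_; _,_)
open import Data.Sum using (_⊎_)
open import Relation.Nullary using (¬_; does)
open import Relation.Binary.PropositionalEquality using (_≡_; _≢_)
open import Relation.Binary.Construct.Closure.ReflexiveTransitive using (Star)

record Graph (n : ℕ) : Set where
  field
    adj    : Fin n → Fin n → Bool
    sym    : ∀ u v → adj u v ≡ adj v u
    irrefl : ∀ v → adj v v ≡ false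

module _ {n : ℕ} (G : Graph n) where
  open Graph G

  Adj : Fin n → Fin n → Set
  Adj u v = T (adj u v)

  degree : Fin n → ℕ
  degree v = length (filterᵇ (adj v) (allFinL n))

  Cubic : Set
  Cubic = ∀ v → degree v ≡ 3

  Connected : Set
  Connected = ∀ u v → Star Adj u v

  Path3 : Fin n → Fin n → Fin n → Fin n → Set
  Path3 t0 t1 t2 t3 =
    Adj t0 t1 × Adj t1 t2 × Adj t2 t3 ×
    t0 ≢ t1 × t0 ≢ t2 × t0 ≢ t3 × t1 ≢ t2 × t1 ≢ t3 × t2 ≢ t3

  -- A closed walk of length len ≥ 1, stored as a len-periodic sequence of
  -- vertices: the walk is (vert 0, vert 1, ..., vert (len-1), vert 0).
  record ClosedWalk : Set where
    field
      len      : ℕ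
      len>0    : 1 ≤ len
      vert     : ℕ → Fin n
      periodic : ∀ i → vert (len + i) ≡ vert i
      adjacent : ∀ i → Adj (vert i) (vert (suc i))

  open ClosedWalk public

  eqᵇ : Fin n → Fin n → Bool
  eqᵇ x y = does (x ≟ y)

  traversals : ClosedWalk → Fin n → Fin n → ℕ
  traversals W x y = length (filterᵇ step (upTo (len W)))
    where
      step : ℕ → Bool
      step i = (eqᵇ (vert W i) x ∧ eqᵇ (vert W (suc i)) y)
             ∨ (eqᵇ (vert W i) y ∧ eqᵇ (vert W (suc i)) x)

  Corner : ClosedWalk → Fin n → Fin n → Fin n → Set
  Corner W a v b = ∃[ i ] (vert W i ≡ a × vert W (suc i) ≡ v × vert W (suc (suc i)) ≡ b)

  -- A (2-cell) embedding of G in a closed (connected) surface, given by its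
  -- collection of facial walks: every edge is traversed exactly twice in
  -- total, and at every vertex v the faces around v form a single disk,
  -- i.e. the link graph at v (vertices: neighbours of v; an edge ab for each
  -- corner (a v b) of a facial walk) is connected.
  record Embedding : Set where
    field
      m     : ℕ
      face  : Fin m → ClosedWalk
      twice : ∀ x y → Adj x y → sum (map (λ f → traversals (face f) x y) (allFinL m)) ≡ 2
      link  : ∀ v a b → Adj v a → Adj v b →
              Star (λ c d → ∃[ f ] (Corner (face f) c v d ⊎ Corner (face f) d v c)) a b

  open Embedding public

  OnFace : ClosedWalk → Fin n → Set
  OnFace W x = ∃[ i ] (vert W i ≡ x)

  EdgeOf : ClosedWalk → Fin n → Fin n → Set
  EdgeOf W x y = ∃[ i ] ((vert W i ≡ x × vert W (suc i) ≡ y) ⊎ (vert W i ≡ y × vert W (suc i) ≡ x))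

  IsCycle : ClosedWalk → Set
  IsCycle W = 3 ≤ len W × (∀ i j → i < len W → j < len W → vert W i ≡ vert W j → i ≡ j)

  GoodIntersection : ClosedWalk → ClosedWalk → Set
  GoodIntersection W W′ =
      (∀ z → OnFace W z → OnFace W′ z → ⊥)
    ⊎ (∃[ x ] (OnFace W x × OnFace W′ x × (∀ z → OnFace W z → OnFace W′ z → z ≡ x)))
    ⊎ (∃[ x ] ∃[ y ] (x ≢ y × EdgeOf W x y × EdgeOf W′ x y ×
          (∀ z → OnFace W z → OnFace W′ z → z ≡ x ⊎ z ≡ y)))

  Polyhedral : Embedding → Set
  Polyhedral Π =
    (∀ f → IsCycle (face Π f)) ×
    (∀ f g → f ≢ g → GoodIntersection (face Π f) (face Π g))

  FacialSubwalk : Embedding → List (Fin n) → Set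
  FacialSubwalk Π w = ∃[ f ] ∃[ i ]
    (  w ≡ map (λ j → vert (face Π f) (i + j)) (upTo (length w))
     ⊎ reverse w ≡ map (λ j → vert (face Π f) (i + j)) (upTo (length w)))

  -- [uv] is a scaffold edge of G^e(Π): u ≠ v and the number of paths
  -- (u t1 t2 v) of G which are Π-facial subwalks is at least 1
  ScaffoldEdge : Embedding → Fin n → Fin n → Set
  ScaffoldEdge Π u v = u ≢ v × ∃[ a ] ∃[ b ] (Path3 u a b v × FacialSubwalk Π (u ∷ a ∷ b ∷ v ∷ []))

module Submission where

-- The argument is local to the ends u and v, which have exactly three neighbours
-- each, and to the faces through them.  After some arithmetic on the positions of
-- a closed walk and of a facial cycle, three facts about a cubic polyhedral
-- embedding are established:
--   * no vertex has four distinct neighbours (cubicity, by counting);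
--   * two distinct faces share no three vertices, and two vertices they share are
--     adjacent (polyhedrality);
--   * for any two neighbours p, q of a vertex z some face has the corner (p z q)
--     (the edge zp lies on two distinct faces, whose corners at z differ).
-- From these follow two propagation rules for a facial 3-path (u a b v): a 3-path
-- from u to v sharing its first (or last) edge with it is facial, and so is a
-- 3-path (u p y v) when p precedes u on the face of (u a b v) and p is adjacent
-- to v only if p = b.  Now either S shares its first or last edge with P or Q, or
-- the vertex before u on the face of S is t₀ or t₂; in every case P or Q is facial
-- (`facialDichotomy`), and the corollary is immediate.

open import Defs
open import Data.Nat using (ℕ; zero; suc; _+_; _*_; _∸_; _≤_; _<_; z≤n; s≤s; pred; NonZero; >-nonZero)
open import Data.Nat.Properties
  using (≤-refl; ≤-trans; suc-injective; +-assoc; +-comm; +-suc; +-cancelʳ-≡;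
         +-mono-<; +-cancelʳ-<; suc-pred; <⇒≢; ≮⇒≥; _<?_; m∸n+n≡m; ≤⇒≯)
open import Data.Nat.DivMod using (_%_; _/_; m≡m%n+[m/n]*n; m%n<n; m%n%n≡m%n; %-distribˡ-+; m<n⇒m%n≡m; [m+n]%n≡m%n)
open import Data.Nat.ListAction using (sum)
open import Data.Fin using (Fin; _≟_)
open import Data.Bool using (Bool; T; T?; _∧_; _∨_)
open import Data.Bool.Properties using (T-∧; T-∨)
open import Data.List using (List; []; _∷_; length; map; filter; filterᵇ; upTo; allFin)
open import Data.List.Properties using (filter-notAll)
open import Data.List.Membership.Propositional using (_∈_)
open import Data.List.Membership.Propositional.Properties using (∈-filter⁺; ∈-filter⁻; ∈-allFin; ∈-upTo⁻)
open import Data.List.Relation.Unary.Any using (here; there)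
import Data.List.Relation.Unary.Any as Any
open import Data.List.Relation.Unary.All using (All; []; _∷_)
import Data.List.Relation.Unary.All as All
open import Data.List.Relation.Unary.AllPairs using ([]; _∷_)
open import Data.List.Relation.Unary.Unique.Propositional using (Unique)
open import Data.List.Relation.Unary.Unique.Propositional.Properties using (filter⁺; allFin⁺; upTo⁺)
open import Data.Product using (∃-syntax; _×_; _,_; proj₁; proj₂)
open import Data.Sum using (_⊎_; inj₁; inj₂; swap; [_,_])
open import Data.Empty using (⊥; ⊥-elim)
open import Function using (_∘_; _∋_)
open import Function.Bundles using (Equivalence)
open import Relation.Nullary using (¬_; yes; no; ¬?)
open import Relation.Binary.Definitions using (DecidableEquality)
open import Relation.Binary.PropositionalEquality using (_≡_; _≢_; refl; sym; trans; cong; cong₂; subst; ≢-sym; module ≡-Reasoning)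


module Counting {A : Set} where

  unique⊆⇒length≤ : DecidableEquality A → ∀ ys xs → Unique ys → All (_∈ xs) ys → length ys ≤ length xs
  unique⊆⇒length≤ _≟ᴬ_ [] xs _ _ = z≤n
  unique⊆⇒length≤ _≟ᴬ_ (y ∷ ys) xs (y∉ys ∷ unique) (y∈xs ∷ ys⊆xs) =
    ≤-trans (s≤s (unique⊆⇒length≤ _≟ᴬ_ ys xs-y unique (inRest ys (All.map ≢-sym y∉ys) ys⊆xs)))
            (filter-notAll (λ x → ¬? (x ≟ᴬ y)) xs (Any.map (λ y≡x x≢y → x≢y (sym y≡x)) y∈xs))
    where
    -- xs without y is shorter than xs, and still contains the rest of ys
    xs-y : List A
    xs-y = filter (λ x → ¬? (x ≟ᴬ y)) xs
    inRest : ∀ zs → All (_≢ y) zs → All (_∈ xs) zs → All (_∈ xs-y) zs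
    inRest [] [] [] = []
    inRest (z ∷ zs) (z≢y ∷ ne) (z∈ ∷ in') = ∈-filter⁺ (λ x → ¬? (x ≟ᴬ y)) z∈ z≢y ∷ inRest zs ne in'

  filterᵇ-witness : ∀ (p : A → Bool) xs → 1 ≤ length (filterᵇ p xs) → ∃[ x ] (x ∈ xs × T (p x))
  filterᵇ-witness p xs nonEmpty with filterᵇ p xs in eq
  ... | x ∷ _ = x , ∈-filter⁻ (T? ∘ p) (subst (x ∈_) (sym eq) (here refl))

  filterᵇ-twoWitnesses : ∀ (p : A → Bool) xs → Unique xs → 2 ≤ length (filterᵇ p xs) →
    ∃[ x ] ∃[ y ] (x ≢ y × (x ∈ xs × T (p x)) × (y ∈ xs × T (p y)))
  filterᵇ-twoWitnesses p xs unique long with filterᵇ p xs in eq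
  filterᵇ-twoWitnesses p xs unique (s≤s ()) | _ ∷ []
  ... | x ∷ y ∷ _ with subst Unique eq (filter⁺ (T? ∘ p) unique)
  ...   | x∉rest ∷ _ = x , y , All.head x∉rest , survivor (here refl) , survivor (there (here refl))
    where
    survivor : ∀ {z} → z ∈ x ∷ y ∷ _ → z ∈ xs × T (p z)
    survivor {z} z∈ = ∈-filter⁻ (T? ∘ p) (subst (z ∈_) (sym eq) z∈)

  positiveTerm : ∀ (g : A → ℕ) xs → 1 ≤ sum (map g xs) → ∃[ x ] (x ∈ xs × 1 ≤ g x)
  positiveTerm g [] ()
  positiveTerm g (x ∷ xs) total with g x in eq
  ... | suc _ = x , here refl , subst (1 ≤_) (sym eq) (s≤s z≤n)
  ... | zero with positiveTerm g xs total
  ...   | y , y∈xs , gy = y , there y∈xs , gy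

  sum≡2 : ∀ (g : A → ℕ) xs → Unique xs → sum (map g xs) ≡ 2 →
    (∃[ x ] 2 ≤ g x) ⊎ (∃[ x ] ∃[ y ] (x ≢ y × 1 ≤ g x × 1 ≤ g y))
  sum≡2 g [] [] ()
  sum≡2 g (x ∷ xs) (x∉xs ∷ unique) total with g x in eq
  ... | suc (suc _) = inj₁ (x , subst (2 ≤_) (sym eq) (s≤s (s≤s z≤n)))
  ... | suc zero with positiveTerm g xs (subst (1 ≤_) (sym (suc-injective total)) ≤-refl)
  ...   | y , y∈xs , gy = inj₂ (x , y , All.lookup x∉xs y∈xs , subst (1 ≤_) (sym eq) ≤-refl , gy)
  sum≡2 g (x ∷ xs) (x∉xs ∷ unique) total | zero = sum≡2 g xs unique total


shiftedResidue : ∀ {L} .{{_ : NonZero L}} k r → 0 < k → k < L → r < L → r ≢ (k + r) % L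
shiftedResidue {L} k r 0<k k<L r<L fixed with k + r <? L
... | yes fits = <⇒≢ 0<k (sym (+-cancelʳ-≡ r k 0 (sym (trans fixed (m<n⇒m%n≡m fits)))))
... | no wraps = <⇒≢ k<L (sym (+-cancelʳ-≡ r L k (begin
    L + r              ≡⟨ +-comm L r ⟩
    r + L              ≡⟨ cong (_+ L) (trans fixed reduced) ⟩
    k + r ∸ L + L      ≡⟨ unwrap ⟩
    k + r              ∎)))
  where
  open ≡-Reasoning
  unwrap : k + r ∸ L + L ≡ k + r
  unwrap = m∸n+n≡m (≮⇒≥ wraps)
  reduced : (k + r) % L ≡ k + r ∸ L
  reduced = begin
    (k + r) % L          ≡⟨ cong (_% L) (sym unwrap) ⟩
    (k + r ∸ L + L) % L  ≡⟨ [m+n]%n≡m%n (k + r ∸ L) L ⟩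
    (k + r ∸ L) % L      ≡⟨ m<n⇒m%n≡m (+-cancelʳ-< L _ L (subst (_< L + L) (sym unwrap) (+-mono-< k<L r<L))) ⟩
    k + r ∸ L            ∎


module Geometry {n : ℕ} (G : Graph n) where
  open Counting

  private
    variable
      a b c d p q r u v x y z : Fin n
      i j : ℕ

  adjSym : Adj G u v → Adj G v u
  adjSym {u} {v} = subst T (Graph.sym G u v)

  adj⇒≢ : Adj G u v → u ≢ v
  adj⇒≢ {u} uv refl = subst T (Graph.irrefl G u) uv

  -- In a cubic graph a neighbour of z is one of any three distinct neighbours of z,
  -- since four distinct neighbours would not fit into the neighbour list of length 3.
  cubic⇒oneOfThree : Cubic G → Adj G z a → Adj G z b → Adj G z c → Adj G z d →
    a ≢ b → a ≢ c → b ≢ c → d ≡ a ⊎ d ≡ b ⊎ d ≡ c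
  cubic⇒oneOfThree {z} {a} {b} {c} {d} cubic za zb zc zd a≢b a≢c b≢c with d ≟ a | d ≟ b | d ≟ c
  ... | yes d≡a | _ | _ = inj₁ d≡a
  ... | no _ | yes d≡b | _ = inj₂ (inj₁ d≡b)
  ... | no _ | no _ | yes d≡c = inj₂ (inj₂ d≡c)
  ... | no d≢a | no d≢b | no d≢c = ⊥-elim (≤⇒≯ fourNeighbours ≤-refl)
    where
    distinct : Unique (a ∷ b ∷ c ∷ d ∷ [])
    distinct = (a≢b ∷ a≢c ∷ ≢-sym d≢a ∷ []) ∷ (b≢c ∷ ≢-sym d≢b ∷ []) ∷ (≢-sym d≢c ∷ []) ∷ [] ∷ []
    listed : Adj G z x → x ∈ filterᵇ (Graph.adj G z) (allFin n)
    listed zx = ∈-filter⁺ (T? ∘ Graph.adj G z) (∈-allFin _) zx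
    fourNeighbours : 4 ≤ 3
    fourNeighbours = subst (4 ≤_) (cubic z)
      (unique⊆⇒length≤ _≟_ _ _ distinct (listed za ∷ listed zb ∷ listed zc ∷ listed zd ∷ []))

  Run : ClosedWalk G → Fin n → Fin n → Fin n → Fin n → Set
  Run W a b c d = ∃[ i ] (vert W i ≡ a × vert W (1 + i) ≡ b × vert W (2 + i) ≡ c × vert W (3 + i) ≡ d)

  data Corner↔ (W : ClosedWalk G) (a b c : Fin n) : Set where
    forward  : Corner G W a b c → Corner↔ W a b c
    backward : Corner G W c b a → Corner↔ W a b c

  data Run↔ (W : ClosedWalk G) (a b c d : Fin n) : Set where
    forward  : Run W a b c d → Run↔ W a b c d
    backward : Run W d c b a → Run↔ W a b c d

  corner↔-flip : ∀ {W} → Corner↔ W a b c → Corner↔ W c b a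
  corner↔-flip (forward t)  = backward t
  corner↔-flip (backward t) = forward t

  run↔-flip : ∀ {W} → Run↔ W a b c d → Run↔ W d c b a
  run↔-flip (forward t)  = backward t
  run↔-flip (backward t) = forward t

  run↔-head : ∀ {W} → Run↔ W a b c d → Corner↔ W a b c
  run↔-head (forward (i , p , q , r , _))  = forward (i , p , q , r)
  run↔-head (backward (i , _ , q , r , s)) = backward (1 + i , q , r , s)

  run↔-tail : ∀ {W} → Run↔ W a b c d → Corner↔ W b c d
  run↔-tail run = corner↔-flip (run↔-head (run↔-flip run))

  edgeAdj : ∀ {W} → EdgeOf G W x y → Adj G x y
  edgeAdj {W = W} (i , inj₁ (refl , refl)) = adjacent W i
  edgeAdj {W = W} (i , inj₂ (refl , refl)) = adjSym (adjacent W i)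

  edgeFlip : ∀ {W} → EdgeOf G W x y → EdgeOf G W y x
  edgeFlip (i , inj₁ step) = i , inj₂ step
  edgeFlip (i , inj₂ step) = i , inj₁ step

  corner↔-edge₁ : ∀ {W} → Corner↔ W a b c → EdgeOf G W a b
  corner↔-edge₁ (forward (i , p , q , _))  = i , inj₁ (p , q)
  corner↔-edge₁ (backward (i , _ , q , r)) = 1 + i , inj₂ (q , r)

  corner↔-edge₂ : ∀ {W} → Corner↔ W a b c → EdgeOf G W b c
  corner↔-edge₂ {W = W} corner = edgeFlip {W = W} (corner↔-edge₁ (corner↔-flip corner))

  corner↔-adj₁ : ∀ {W} → Corner↔ W a b c → Adj G a b
  corner↔-adj₁ {W = W} corner = edgeAdj {W = W} (corner↔-edge₁ corner)

  corner↔-adj₂ : ∀ {W} → Corner↔ W a b c → Adj G b c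
  corner↔-adj₂ {W = W} corner = edgeAdj {W = W} (corner↔-edge₂ corner)

  corner↔-vertices : ∀ {W} → Corner↔ W a b c → OnFace G W a × OnFace G W b × OnFace G W c
  corner↔-vertices (forward (i , p , q , r))  = (i , p) , (1 + i , q) , (2 + i , r)
  corner↔-vertices (backward (i , p , q , r)) = (2 + i , r) , (1 + i , q) , (i , p)

  run↔-vertices : ∀ {W} → Run↔ W a b c d → OnFace G W a × OnFace G W b × OnFace G W c × OnFace G W d
  run↔-vertices run =
    let (a∈ , b∈ , _) = corner↔-vertices (run↔-head run)
        (_ , c∈ , d∈) = corner↔-vertices (run↔-tail run)
    in a∈ , b∈ , c∈ , d∈

  window : ∀ (W : ClosedWalk G) i → map (λ (j : ℕ) → vert W (i + j)) (upTo 4) ≡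
    (List (Fin n) ∋ vert W i ∷ vert W (1 + i) ∷ vert W (2 + i) ∷ vert W (3 + i) ∷ [])
  window W i = cong₂ _∷_ (entry 0) (cong₂ _∷_ (entry 1) (cong₂ _∷_ (entry 2) (cong₂ _∷_ (entry 3) refl)))
    where
    entry : ∀ k → vert W (i + k) ≡ vert W (k + i)
    entry k = cong (vert W) (+-comm i k)

  entries : ∀ {a′ b′ c′ d′} → _≡_ {A = List (Fin n)} (a ∷ b ∷ c ∷ d ∷ []) (a′ ∷ b′ ∷ c′ ∷ d′ ∷ []) →
    a′ ≡ a × b′ ≡ b × c′ ≡ c × d′ ≡ d
  entries refl = refl , refl , refl , refl

  path3-flip : Path3 G u x y v → Path3 G v y x u
  path3-flip (ux , xy , yv , u≢x , u≢y , u≢v , x≢y , x≢v , y≢v) =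
    adjSym yv , adjSym xy , adjSym ux , ≢-sym y≢v , ≢-sym x≢v , ≢-sym u≢v , ≢-sym x≢y , ≢-sym u≢y , ≢-sym u≢x

  Traversal : ClosedWalk G → Fin n → Fin n → ℕ → Set
  Traversal W x y i = i < len W × ((vert W i ≡ x × vert W (1 + i) ≡ y) ⊎ (vert W i ≡ y × vert W (1 + i) ≡ x))

  traversal⇒edge : ∀ {W} → Traversal W x y i → EdgeOf G W x y
  traversal⇒edge {i = i} (_ , step) = i , step

  private
    eqᵇ⇒≡ : T (eqᵇ G x y) → x ≡ y
    eqᵇ⇒≡ {x} {y} t with x ≟ y
    ... | yes x≡y = x≡y
    ... | no _    = ⊥-elim t

    decodeStep : T ((eqᵇ G a x ∧ eqᵇ G b y) ∨ (eqᵇ G a y ∧ eqᵇ G b x)) → (a ≡ x × b ≡ y) ⊎ (a ≡ y × b ≡ x)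
    decodeStep t with Equivalence.to T-∨ t
    ... | inj₁ t₁ = let (e , e′) = Equivalence.to T-∧ t₁ in inj₁ (eqᵇ⇒≡ e , eqᵇ⇒≡ e′)
    ... | inj₂ t₂ = let (e , e′) = Equivalence.to T-∧ t₂ in inj₂ (eqᵇ⇒≡ e , eqᵇ⇒≡ e′)

  traversalOf : ∀ W → 1 ≤ traversals G W x y → ∃[ i ] Traversal W x y i
  traversalOf W counted with filterᵇ-witness _ (upTo (len W)) counted
  ... | i , i∈ , step = i , ∈-upTo⁻ i∈ , decodeStep step

  twoTraversals : ∀ W → 2 ≤ traversals G W x y → ∃[ i ] ∃[ j ] (i ≢ j × Traversal W x y i × Traversal W x y j)
  twoTraversals W counted with filterᵇ-twoWitnesses _ (upTo (len W)) (upTo⁺ (len W)) counted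
  ... | i , j , i≢j , (i∈ , stepᵢ) , (j∈ , stepⱼ) = i , j , i≢j , (∈-upTo⁻ i∈ , decodeStep stepᵢ) , (∈-upTo⁻ j∈ , decodeStep stepⱼ)

  OnBoth : ClosedWalk G → ClosedWalk G → Fin n → Set
  OnBoth W W′ x = OnFace G W x × OnFace G W′ x

  noThreeCommon : ∀ {W W′} → GoodIntersection G W W′ → OnBoth W W′ x → OnBoth W W′ y → OnBoth W W′ z →
    x ≢ y → x ≢ z → y ≢ z → ⊥
  noThreeCommon {x} {y} {z} (inj₁ disjoint) (x∈ , x∈′) _ _ _ _ _ = disjoint x x∈ x∈′
  noThreeCommon {x} {y} {z} (inj₂ (inj₁ (_ , _ , _ , only))) (x∈ , x∈′) (y∈ , y∈′) _ x≢y _ _ =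
    x≢y (trans (only x x∈ x∈′) (sym (only y y∈ y∈′)))
  noThreeCommon {x} {y} {z} (inj₂ (inj₂ (_ , _ , _ , _ , _ , only))) (x∈ , x∈′) (y∈ , y∈′) (z∈ , z∈′) x≢y x≢z y≢z
    with only x x∈ x∈′ | only y y∈ y∈′ | only z z∈ z∈′
  ... | inj₁ refl | inj₁ refl | _         = x≢y refl
  ... | inj₂ refl | inj₂ refl | _         = x≢y refl
  ... | inj₁ refl | inj₂ refl | inj₁ refl = x≢z refl
  ... | inj₁ refl | inj₂ refl | inj₂ refl = y≢z refl
  ... | inj₂ refl | inj₁ refl | inj₁ refl = y≢z refl
  ... | inj₂ refl | inj₁ refl | inj₂ refl = x≢z refl

  twoCommon⇒adjacent : ∀ {W W′} → GoodIntersection G W W′ → OnBoth W W′ x → OnBoth W W′ y → x ≢ y → Adj G x y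
  twoCommon⇒adjacent {x} (inj₁ disjoint) (x∈ , x∈′) _ _ = ⊥-elim (disjoint x x∈ x∈′)
  twoCommon⇒adjacent {x} {y} (inj₂ (inj₁ (_ , _ , _ , only))) (x∈ , x∈′) (y∈ , y∈′) x≢y =
    ⊥-elim (x≢y (trans (only x x∈ x∈′) (sym (only y y∈ y∈′))))
  twoCommon⇒adjacent {x} {y} {W = W} (inj₂ (inj₂ (_ , _ , _ , xy∈W , _ , only))) (x∈ , x∈′) (y∈ , y∈′) x≢y
    with only x x∈ x∈′ | only y y∈ y∈′
  ... | inj₁ refl | inj₁ refl = ⊥-elim (x≢y refl)
  ... | inj₁ refl | inj₂ refl = edgeAdj {W = W} xy∈W
  ... | inj₂ refl | inj₁ refl = adjSym (edgeAdj {W = W} xy∈W)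
  ... | inj₂ refl | inj₂ refl = ⊥-elim (x≢y refl)

  module WalkSteps (W : ClosedWalk G) where

    instance
      len≢0 : NonZero (len W)
      len≢0 = >-nonZero (len>0 W)

    private
      L : ℕ
      L = len W

    -- Position pred L + i precedes position i, so W can be read backwards.
    behind : ∀ k i → vert W (k + suc (pred L + i)) ≡ vert W (k + i)
    behind k i = trans (cong (vert W) wrapped) (periodic W (k + i))
      where
      open ≡-Reasoning
      wrapped : k + suc (pred L + i) ≡ L + (k + i)
      wrapped = begin
        k + suc (pred L + i) ≡⟨ cong (λ l → k + (l + i)) (suc-pred L) ⟩
        k + (L + i)          ≡⟨ sym (+-assoc k L i) ⟩
        k + L + i            ≡⟨ cong (_+ i) (+-comm k L) ⟩
        L + k + i            ≡⟨ +-assoc L k i ⟩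
        L + (k + i)          ∎

    extend↔ : Corner↔ W a b c → ∃[ d ] Run↔ W a b c d
    extend↔ (forward (i , p , q , r)) = vert W (3 + i) , forward (i , p , q , r , refl)
    extend↔ (backward (i , q , r , s)) =
      vert W (pred L + i) ,
      backward (pred L + i , refl , trans (behind 0 i) q , trans (behind 1 i) r , trans (behind 2 i) s)

    precede : Corner↔ W a b c → ∃[ p ] Corner↔ W p a b
    precede abc = let (p , cbap) = extend↔ (corner↔-flip abc) in p , corner↔-flip (run↔-tail cbap)

    edgeCorner : EdgeOf G W z p → ∃[ c ] Corner↔ W c z p
    edgeCorner (i , inj₁ (zᵢ , pᵢ)) =
      vert W (pred L + i) , forward (pred L + i , refl , trans (behind 0 i) zᵢ , trans (behind 1 i) pᵢ)
    edgeCorner (i , inj₂ (pᵢ , zᵢ)) = vert W (2 + i) , backward (i , pᵢ , zᵢ , refl)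

  module CycleSteps (W : ClosedWalk G) (cycle : IsCycle G W) where
    open WalkSteps W
    open ≡-Reasoning

    private
      L : ℕ
      L = len W
      V : ℕ → Fin n
      V = vert W

    periodicMultiple : ∀ k i → V (k * L + i) ≡ V i
    periodicMultiple zero    i = refl
    periodicMultiple (suc k) i = trans (cong V (+-assoc L (k * L) i)) (trans (periodic W (k * L + i)) (periodicMultiple k i))

    reduce : ∀ i → V i ≡ V (i % L)
    reduce i = begin
      V i                     ≡⟨ cong V (m≡m%n+[m/n]*n i L) ⟩
      V (i % L + i / L * L)   ≡⟨ cong V (+-comm (i % L) (i / L * L)) ⟩
      V (i / L * L + i % L)   ≡⟨ periodicMultiple (i / L) (i % L) ⟩
      V (i % L)               ∎

    samePosition : V i ≡ V j → i % L ≡ j % L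
    samePosition {i} {j} same =
      proj₂ cycle (i % L) (j % L) (m%n<n i L) (m%n<n j L) (trans (sym (reduce i)) (trans same (reduce j)))

    advance : V i ≡ V j → ∀ k → V (k + i) ≡ V (k + j)
    advance {i} {j} same k = begin
      V (k + i)                 ≡⟨ reduce (k + i) ⟩
      V ((k + i) % L)           ≡⟨ cong V (%-distribˡ-+ k i L) ⟩
      V ((k % L + i % L) % L)   ≡⟨ cong (λ l → V ((k % L + l) % L)) (samePosition same) ⟩
      V ((k % L + j % L) % L)   ≡⟨ cong V (sym (%-distribˡ-+ k j L)) ⟩
      V ((k + j) % L)           ≡⟨ sym (reduce (k + j)) ⟩
      V (k + j)                 ∎

    noEarlyReturn : ∀ i k → 0 < k → k < L → V i ≢ V (k + i)
    noEarlyReturn i k 0<k k<L same = shiftedResidue k (i % L) 0<k k<L (m%n<n i L) (begin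
      i % L                    ≡⟨ samePosition same ⟩
      (k + i) % L              ≡⟨ %-distribˡ-+ k i L ⟩
      (k % L + i % L) % L      ≡⟨ cong (λ l → (k % L + l) % L) (sym (m%n%n≡m%n i L)) ⟩
      (k % L + i % L % L) % L  ≡⟨ sym (%-distribˡ-+ k (i % L) L) ⟩
      (k + i % L) % L          ∎)

    private
      noReturnIn2 : ∀ i → V i ≢ V (2 + i)
      noReturnIn2 i = noEarlyReturn i 2 (s≤s z≤n) (proj₁ cycle)

      stepBack : ∀ i → V (pred L + suc i) ≡ V i
      stepBack i = trans (cong V (+-suc (pred L) i)) (behind 0 i)

      directedNeighbours : Corner G W p q r → EdgeOf G W q z → z ≡ p ⊎ z ≡ r
      directedNeighbours (i , refl , refl , refl) (j , inj₁ (qⱼ , refl)) = inj₂ (advance qⱼ 1)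
      directedNeighbours (i , refl , refl , refl) (j , inj₂ (refl , qⱼ)) =
        inj₁ (trans (sym (stepBack j)) (trans (advance qⱼ (pred L)) (stepBack i)))

    corner↔-ends≢ : Corner↔ W a b c → a ≢ c
    corner↔-ends≢ (forward (i , refl , _ , refl))  = noReturnIn2 i
    corner↔-ends≢ (backward (i , refl , _ , refl)) = ≢-sym (noReturnIn2 i)

    cornerNeighbours : Corner↔ W p q r → EdgeOf G W q z → z ≡ p ⊎ z ≡ r
    cornerNeighbours (forward c)  e = directedNeighbours c e
    cornerNeighbours (backward c) e = swap (directedNeighbours c e)

    traversedOnce : Traversal W x y i → Traversal W x y j → i ≡ j
    traversedOnce (i< , inj₁ (xᵢ , _)) (j< , inj₁ (xⱼ , _)) = proj₂ cycle _ _ i< j< (trans xᵢ (sym xⱼ))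
    traversedOnce (i< , inj₂ (yᵢ , _)) (j< , inj₂ (yⱼ , _)) = proj₂ cycle _ _ i< j< (trans yᵢ (sym yⱼ))
    traversedOnce {i = i} (_ , inj₁ (xᵢ , yᵢ₊₁)) (_ , inj₂ (yⱼ , xⱼ₊₁)) =
      ⊥-elim (noReturnIn2 i (trans xᵢ (sym (trans (advance (trans yᵢ₊₁ (sym yⱼ)) 1) xⱼ₊₁))))
    traversedOnce {j = j} (_ , inj₂ (yᵢ , xᵢ₊₁)) (_ , inj₁ (xⱼ , yⱼ₊₁)) =
      ⊥-elim (noReturnIn2 j (trans xⱼ (sym (trans (advance (trans yⱼ₊₁ (sym yᵢ)) 1) xᵢ₊₁))))


module CubicPolyhedral {n : ℕ} {G : Graph n} (cubic : Cubic G) (Π : Embedding G) (polyhedral : Polyhedral G Π) where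
  open Counting
  open Geometry G

  F : Fin (m Π) → ClosedWalk G
  F = face Π

  FacialRun : Fin n → Fin n → Fin n → Fin n → Set
  FacialRun a b c d = ∃[ f ] Run↔ (F f) a b c d

  facialRun-flip : ∀ {a b c d} → FacialRun a b c d → FacialRun d c b a
  facialRun-flip (f , run) = f , run↔-flip run

  facial⇒run : ∀ {a b c d} → FacialSubwalk G Π (a ∷ b ∷ c ∷ d ∷ []) → FacialRun a b c d
  facial⇒run (f , i , inj₁ eq) = f , forward (i , entries (trans eq (window (F f) i)))
  facial⇒run (f , i , inj₂ eq) = f , backward (i , entries (trans eq (window (F f) i)))

  run⇒facial : ∀ {a b c d} → FacialRun a b c d → FacialSubwalk G Π (a ∷ b ∷ c ∷ d ∷ [])
  run⇒facial (f , forward (i , refl , refl , refl , refl))  = f , i , inj₁ (sym (window (F f) i))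
  run⇒facial (f , backward (i , refl , refl , refl , refl)) = f , i , inj₂ (sym (window (F f) i))

  meet : ∀ {f g} → f ≢ g → GoodIntersection G (F f) (F g)
  meet {f} {g} = proj₂ polyhedral f g

  ends≢ : ∀ f {a b c} → Corner↔ (F f) a b c → a ≢ c
  ends≢ f = CycleSteps.corner↔-ends≢ (F f) (proj₁ polyhedral f)

  neighboursOnFace : ∀ f {p q r z} → Corner↔ (F f) p q r → EdgeOf G (F f) q z → z ≡ p ⊎ z ≡ r
  neighboursOnFace f = CycleSteps.cornerNeighbours (F f) (proj₁ polyhedral f)

  noCommonCorner : ∀ {f g a b c} → f ≢ g → Corner↔ (F f) a b c → Corner↔ (F g) a b c → ⊥
  noCommonCorner {f} {g} f≢g abc abc′ =
    let (a∈ , b∈ , c∈) = corner↔-vertices abc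
        (a∈′ , b∈′ , c∈′) = corner↔-vertices abc′
    in noThreeCommon {W = F f} {W′ = F g} (meet f≢g) (a∈ , a∈′) (b∈ , b∈′) (c∈ , c∈′)
         (adj⇒≢ (corner↔-adj₁ abc)) (ends≢ f abc) (adj⇒≢ (corner↔-adj₂ abc))

  traversedEdge : ∀ f {x y} → 1 ≤ traversals G (F f) x y → EdgeOf G (F f) x y
  traversedEdge f counted = traversal⇒edge {W = F f} (proj₂ (traversalOf (F f) counted))

  -- The
  -- edge zp is traversed twice by the faces, which are cycles, so it lies on two
  -- distinct faces, with corners (c z p) and (c′ z p).  If neither c nor c′ is q,
  -- cubicity at z forces c = c′ and the two faces would share a corner.
  faceCorner : ∀ {z p q} → Adj G z p → Adj G z q → p ≢ q → ∃[ f ] Corner↔ (F f) p z q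
  faceCorner {z} {p} {q} zp zq p≢q
    with sum≡2 (λ f → traversals G (F f) z p) (allFin (m Π)) (allFin⁺ (m Π)) (twice Π z p zp)
  ... | inj₁ (f , twiceOnF) =
    let (i , j , i≢j , tᵢ , tⱼ) = twoTraversals (F f) twiceOnF
    in ⊥-elim (i≢j (CycleSteps.traversedOnce (F f) (proj₁ polyhedral f) tᵢ tⱼ))
  ... | inj₂ (f , f′ , f≢f′ , onF , onF′)
    with WalkSteps.edgeCorner (F f) (traversedEdge f onF) | WalkSteps.edgeCorner (F f′) (traversedEdge f′ onF′)
  ... | c , czp | c′ , c′zp with c ≟ q | c′ ≟ q
  ...   | yes refl | _        = f , corner↔-flip czp
  ...   | no _     | yes refl = f′ , corner↔-flip c′zp
  ...   | no c≢q   | no c′≢q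
    with cubic⇒oneOfThree cubic zp zq (adjSym (corner↔-adj₁ czp)) (adjSym (corner↔-adj₁ c′zp))
           p≢q (≢-sym (ends≢ f czp)) (≢-sym c≢q)
  ...     | inj₁ c′≡p        = ⊥-elim (ends≢ f′ c′zp c′≡p)
  ...     | inj₂ (inj₁ c′≡q) = ⊥-elim (c′≢q c′≡q)
  ...     | inj₂ (inj₂ refl) = ⊥-elim (noCommonCorner f≢f′ czp c′zp)

  runThrough : ∀ {x y z} → Adj G x y → Adj G y z → x ≢ z → ∃[ g ] ∃[ r ] Run↔ (F g) r x y z
  runThrough xy yz x≢z with faceCorner (adjSym xy) yz x≢z
  ... | g , xyz with WalkSteps.extend↔ (F g) (corner↔-flip xyz)
  ...   | r , zyxr = g , r , run↔-flip zyxr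

  -- Otherwise y ≠ b and the face through (x y v) continues to some r ≠ u before x;
  -- by cubicity at x, r = b.  The faces of (u x b v) and (b x y v) then either
  -- coincide, giving x the third neighbour y along one face, or share x, b and v.
  sharedFirstEdge : ∀ {f u x b y v} → Run↔ (F f) u x b v → Path3 G u x y v → FacialRun u x y v
  sharedFirstEdge {f} {u} {x} {b} {y} {v} S (ux , xy , yv , _ , u≢y , _ , _ , x≢v , _) with y ≟ b
  ... | yes refl = f , S
  ... | no y≢b with runThrough xy yv x≢v
  ...   | g , r , R with r ≟ u
  ...     | yes refl = g , R
  ...     | no r≢u
    with cubic⇒oneOfThree cubic (adjSym ux) (corner↔-adj₂ (run↔-head S)) xy (adjSym (corner↔-adj₁ (run↔-head R)))
           (ends≢ f (run↔-head S)) u≢y (≢-sym y≢b)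
  ...       | inj₁ r≡u        = ⊥-elim (r≢u r≡u)
  ...       | inj₂ (inj₂ r≡y) = ⊥-elim (ends≢ g (run↔-head R) r≡y)
  ...       | inj₂ (inj₁ refl) with f ≟ g
  ...         | yes refl =
    ⊥-elim ([ ≢-sym u≢y , y≢b ] (neighboursOnFace f (run↔-head S) (corner↔-edge₂ (run↔-head R))))
  ...         | no f≢g =
    let (_ , x∈ , b∈ , v∈) = run↔-vertices S
        (b∈′ , x∈′ , _ , v∈′) = run↔-vertices R
    in ⊥-elim (noThreeCommon {W = F f} {W′ = F g} (meet f≢g) (x∈ , x∈′) (b∈ , b∈′) (v∈ , v∈′)
                 (adj⇒≢ (corner↔-adj₂ (run↔-head S))) x≢v (adj⇒≢ (corner↔-adj₂ (run↔-tail S))))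

  sharedLastEdge : ∀ {f u a x y v} → Run↔ (F f) u a y v → Path3 G u x y v → FacialRun u x y v
  sharedLastEdge S P = facialRun-flip (sharedFirstEdge (run↔-flip S) (path3-flip P))

  -- Then (u p y v) is facial:
  -- otherwise the face through (p y v) continues to some r ≠ u before p.  It is not
  -- the face of (u a b v), on which p is adjacent to u, so the two faces share p
  -- and v, which are then adjacent; hence p = b, and b would have the neighbour u
  -- besides a and v on that face.
  throughPredecessor : ∀ {f u p a b v y} → Corner↔ (F f) p u a → Corner↔ (F f) a b v → Path3 G u p y v →
    (Adj G p v → p ≡ b) → FacialRun u p y v
  throughPredecessor {f} {u} {p} {a} {b} {v} {y} pua abv (_ , py , yv , _ , u≢y , u≢v , _ , p≢v , _) onlyB
    with runThrough py yv p≢v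
  ... | g , r , R with r ≟ u
  ...   | yes refl = g , R
  ...   | no r≢u with f ≟ g
  ...     | yes refl = ⊥-elim ([ ≢-sym r≢u , u≢y ] (neighboursOnFace f (run↔-head R) (corner↔-edge₁ pua)))
  ...     | no f≢g = ⊥-elim (p≢b (onlyB (twoCommon⇒adjacent {W = F f} {W′ = F g} (meet f≢g) (p∈ , p∈′) (v∈ , v∈′) p≢v)))
    where
    p∈ = proj₁ (corner↔-vertices pua)
    v∈ = proj₂ (proj₂ (corner↔-vertices abv))
    p∈′ = proj₁ (proj₂ (run↔-vertices R))
    v∈′ = proj₂ (proj₂ (proj₂ (run↔-vertices R)))
    -- along the face, b is adjacent to a and v only, whereas p is adjacent to u
    p≢b : p ≢ b
    p≢b p≡b = [ adj⇒≢ (corner↔-adj₂ pua) , u≢v ]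
      (neighboursOnFace f (subst (λ w → Corner↔ (F f) a w v) (sym p≡b) abv) (corner↔-edge₁ pua))

  -- If S shares its first or last edge with
  -- P or Q, that path is facial.  Otherwise the neighbours of u are t₀, t₂, a and
  -- those of v are t₁, t₃, b, so the vertex p before u on the face of S is t₀ or t₂,
  -- and it is adjacent to v only if p = b.
  facialDichotomy : ∀ {u t₀ t₁ t₂ t₃ v f a b} → Path3 G u t₀ t₁ v → Path3 G u t₂ t₃ v →
    t₀ ≢ t₂ × t₀ ≢ t₃ × t₁ ≢ t₂ × t₁ ≢ t₃ → Run↔ (F f) u a b v →
    FacialRun u t₀ t₁ v ⊎ FacialRun u t₂ t₃ v
  facialDichotomy {u} {t₀} {t₁} {t₂} {t₃} {v} {f} {a} {b}
    P@(ut₀ , _ , t₁v , _ , _ , _ , t₀≢t₁ , _ , _) Q@(ut₂ , _ , t₃v , _ , _ , _ , t₂≢t₃ , _ , _)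
    (t₀≢t₂ , t₀≢t₃ , t₁≢t₂ , t₁≢t₃) S
    with a ≟ t₀ | a ≟ t₂ | b ≟ t₁ | b ≟ t₃
  ... | yes refl | _ | _ | _ = inj₁ (sharedFirstEdge S P)
  ... | _ | yes refl | _ | _ = inj₂ (sharedFirstEdge S Q)
  ... | _ | _ | yes refl | _ = inj₁ (sharedLastEdge S P)
  ... | _ | _ | _ | yes refl = inj₂ (sharedLastEdge S Q)
  ... | no a≢t₀ | no a≢t₂ | no b≢t₁ | no b≢t₃ = viaPredecessor (proj₂ (WalkSteps.precede (F f) (run↔-head S)))
    where
    abv : Corner↔ (F f) a b v
    abv = run↔-tail S

    -- v has the three distinct neighbours t₁, t₃ and b
    onlyB : ∀ {w} → w ≢ t₁ → w ≢ t₃ → Adj G w v → w ≡ b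
    onlyB w≢t₁ w≢t₃ wv
      with cubic⇒oneOfThree cubic (adjSym t₁v) (adjSym t₃v) (adjSym (corner↔-adj₂ abv)) (adjSym wv)
             t₁≢t₃ (≢-sym b≢t₁) (≢-sym b≢t₃)
    ... | inj₁ w≡t₁        = ⊥-elim (w≢t₁ w≡t₁)
    ... | inj₂ (inj₁ w≡t₃) = ⊥-elim (w≢t₃ w≡t₃)
    ... | inj₂ (inj₂ w≡b)  = w≡b

    -- u has the three distinct neighbours t₀, t₂ and a, so its predecessor p ≠ a is t₀ or t₂
    viaPredecessor : ∀ {p} → Corner↔ (F f) p u a → FacialRun u t₀ t₁ v ⊎ FacialRun u t₂ t₃ v
    viaPredecessor pua
      with cubic⇒oneOfThree cubic ut₀ ut₂ (corner↔-adj₁ (run↔-head S)) (adjSym (corner↔-adj₁ pua))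
             t₀≢t₂ (≢-sym a≢t₀) (≢-sym a≢t₂)
    ... | inj₁ refl        = inj₁ (throughPredecessor pua abv P (onlyB t₀≢t₁ t₀≢t₃))
    ... | inj₂ (inj₁ refl) = inj₂ (throughPredecessor pua abv Q (onlyB (≢-sym t₁≢t₂) t₂≢t₃))
    ... | inj₂ (inj₂ p≡a)  = ⊥-elim (ends≢ f pua p≡a)

corollary13 : ∀ {n : ℕ} (G : Graph n) → Cubic G → Connected G →
    (Π : Embedding G) → Polyhedral G Π →
    ∀ (u t₀ t₁ t₂ t₃ v : Fin n) →
    Path3 G u t₀ t₁ v → Path3 G u t₂ t₃ v →
    (t₀ ≢ t₂ × t₀ ≢ t₃ × t₁ ≢ t₂ × t₁ ≢ t₃) →
    ScaffoldEdge G Π u v →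
    ¬ FacialSubwalk G Π (u ∷ t₀ ∷ t₁ ∷ v ∷ []) →
    FacialSubwalk G Π (u ∷ t₂ ∷ t₃ ∷ v ∷ [])
corollary13 G cubic _ Π polyhedral u t₀ t₁ t₂ t₃ v P Q disjoint (_ , _ , _ , _ , S) P-notFacial =
  conclude (facialDichotomy P Q disjoint (proj₂ (facial⇒run S)))
  where
  open CubicPolyhedral cubic Π polyhedral
  conclude : FacialRun u t₀ t₁ v ⊎ FacialRun u t₂ t₃ v → FacialSubwalk G Π (u ∷ t₂ ∷ t₃ ∷ v ∷ [])
  conclude (inj₁ P-facial) = ⊥-elim (P-notFacial (run⇒facial P-facial))
  conclude (inj₂ Q-facial) = run⇒facial Q-facial
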